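{- Let $n$ be an odd positive integer. Then there exists a digraph $R\in\mathcal{RS}_n$ whose arc set consists of exactly one loop together with $(n-1)/2$ pairwise vertex-disjoint directed $2$-cycles (cyclically oriented digons $(a,b),(b,a)$), covering all $n$ vertices.
   Context: For integers $a\le b$, $[a,b]=\{a,\ldots,b\}$. $\mathcal{S}_n$ denotes the set of all digraphs $S$ with vertex set $[1,n]$ (loops allowed) such that every vertex has exactly one outgoing arc and exactly one incoming arc (a loop counts as both), and such that the $n$ numbers $i+j$, for $(i,j)\in E(S)$ (a loop at $i$ giving $2i$), are pairwise distinct and form a set of $n$ consecutive integers. For a square matrix $M=(a_{i,j})$ of order $n$, its rotation is $M^R=(a^R_{i,j})$ with $a^R_{i,j}=a_{n+1-j,i}$. $\mathcal{RS}_n$ is the set of digraphs on vertex set $[1,n]$ whose adjacency matrix is the rotation of the adjacency matrix of some element of $\mathcal{S}_n$; equivalently, $R\in\mathcal{RS}_n$ iff there is $S\in\mathcal{S}_n$ with $(i,j)\in E(R)\iff (n+1-j,i)\in E(S)$. -}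

module Defs where

open import Data.Nat using (ℕ; suc; _+_; _≤_; _<_)
open import Data.Fin using (Fin; toℕ; opposite)
open import Data.Bool using (Bool; true)
open import Data.Product using (Σ; _×_; _,_; ∃)
open import Data.Sum using (_⊎_)
open import Relation.Binary.PropositionalEquality using (_≡_)
open import Relation.Nullary using (¬_)

-- A digraph on vertex set [1,n] (loops allowed) is given by its adjacency
-- matrix; vertex i ∈ [1,n] is represented by the element of Fin n with toℕ = i-1.
Digraph : ℕ → Set
Digraph n = Fin n → Fin n → Bool

lab : {n : ℕ} → Fin n → ℕ
lab i = suc (toℕ i)

Arc : {n : ℕ} → Digraph n → Fin n → Fin n → Set
Arc A i j = A i j ≡ true

OneOut : {n : ℕ} → Digraph n → Set
OneOut {n} A = (i : Fin n) → Σ (Fin n) λ j → Arc A i j × ((k : Fin n) → Arc A i k → k ≡ j)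

OneIn : {n : ℕ} → Digraph n → Set
OneIn {n} A = (j : Fin n) → Σ (Fin n) λ i → Arc A i j × ((k : Fin n) → Arc A k j → k ≡ i)

DistinctSums : {n : ℕ} → Digraph n → Set
DistinctSums {n} A = (i j i' j' : Fin n) → Arc A i j → Arc A i' j' →
  lab i + lab j ≡ lab i' + lab j' → (i ≡ i' × j ≡ j')

ConsecutiveSums : {n : ℕ} → Digraph n → Set
ConsecutiveSums {n} A = Σ ℕ λ c →
  ((i j : Fin n) → Arc A i j → (c ≤ lab i + lab j × lab i + lab j < c + n)) ×
  ((m : ℕ) → c ≤ m → m < c + n → Σ (Fin n) λ i → Σ (Fin n) λ j → Arc A i j × lab i + lab j ≡ m)

InS : (n : ℕ) → Digraph n → Set
InS n S = OneOut S × OneIn S × DistinctSums S × ConsecutiveSums S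

-- rotation of a square matrix: M^R i j = M (n+1-j) i  (opposite j has label n+1-lab j)
rotate : {n : ℕ} → Digraph n → Digraph n
rotate M i j = M (opposite j) i

InRS : (n : ℕ) → Digraph n → Set
InRS n R = Σ (Digraph n) λ S → InS n S × ((i j : Fin n) → R i j ≡ rotate S i j)

LoopAndDigons : {n : ℕ} (m : ℕ) → Digraph n → Set
LoopAndDigons {n} m R = Σ (Fin n) λ v → Σ (Fin m → Fin n) λ a → Σ (Fin m → Fin n) λ b →
  ((i j : Fin n) → Arc R i j →
      (i ≡ v × j ≡ v) ⊎ (Σ (Fin m) λ t → (i ≡ a t × j ≡ b t) ⊎ (i ≡ b t × j ≡ a t))) ×
  Arc R v v ×
  ((t : Fin m) → Arc R (a t) (b t) × Arc R (b t) (a t)) ×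
  ((t : Fin m) → ¬ a t ≡ b t × ¬ a t ≡ v × ¬ b t ≡ v) ×
  ((t t' : Fin m) → ¬ t ≡ t' →
      ¬ a t ≡ a t' × ¬ a t ≡ b t' × ¬ b t ≡ a t' × ¬ b t ≡ b t') ×
  ((u : Fin n) → u ≡ v ⊎ (Σ (Fin m) λ t → u ≡ a t ⊎ u ≡ b t))

module Submission where

-- Let n = 2m+1 and identify the vertices [1,n] with Fin n (vertex x ↦ toℕ x ∈ [0,2m]).
-- The reflection ρ = opposite (x ↦ 2m - x) is an involution of Fin n with exactly one
-- fixed point m and the 2-cycles {t, 2m-t}, t < m.  Conjugating ρ by any permutation
-- δ gives an involution σ = δ ∘ ρ ∘ δ⁻¹ whose graph R (arcs x → σ x) consists of one
-- loop and m vertex-disjoint digons; moreover R = rotate S for the digraph S with arcs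
-- ρ(σ i) → i, which is again the graph of a permutation.
--
-- It remains to choose δ so that the arc sums of S are consecutive.  We let δ be the
-- inverse of the "key" bijection κ of [0,2m]: κ(a) = 2a+1 for a < m and
-- κ(m+a) = 2a for a ≤ m.  The arithmetic identity δ(d) + m = δ(2m-d) + d then shows
-- that the arc of S entering i has sum m + κ(i) (0-indexed), so the arc sums run
-- through m, …, 3m exactly once.

open import Defs
open import Data.Nat using (ℕ; zero; suc; _+_; _*_; _∸_; _%_; _/_; _≤_; _<_; s≤s; s≤s⁻¹; _<?_)
open import Data.Nat.Properties
  using (suc-injective; +-suc; +-assoc; *-comm; *-suc; +-identityʳ; *-distribˡ-+;
         +-cancelˡ-≡; +-cancelʳ-≡; *-cancelˡ-≡; +-cancelˡ-<; *-cancelˡ-≤; *-cancelˡ-<;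
         ≤-trans; <-trans; <⇒≤; <⇒≢; ≮⇒≥; <-cmp; n≤1+n; m≤m+n; m+n≮m; even≢odd;
         +-monoʳ-≤; +-monoʳ-<; +-mono-<-≤; *-monoʳ-≤; *-monoʳ-<; m+[n∸m]≡n; m≤n+o⇒m∸n≤o)
open import Data.Nat.DivMod using (m≡m%n+[m/n]*n; m*n/n≡m)
open import Data.Nat.Tactic.RingSolver using (solve-∀)
open import Data.Fin using (Fin; toℕ; fromℕ<; inject≤; opposite; _≟_)
open import Data.Fin.Properties using (toℕ-injective; toℕ-fromℕ<; toℕ<n; toℕ-inject≤; inject≤-injective; opposite-prop; opposite-involutive)
open import Data.Product using (Σ; ∃; _×_; _,_; proj₁; proj₂)
open import Data.Sum using (_⊎_; inj₁; inj₂)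
open import Data.Empty using (⊥-elim)
open import Function using (_∘_)
open import Relation.Nullary using (yes; no; does)
open import Relation.Nullary.Decidable using (dec-true)
open import Relation.Binary.Definitions using (tri<; tri≈; tri>)
open import Relation.Binary.PropositionalEquality using (_≡_; _≢_; refl; sym; trans; cong; cong₂; subst; module ≡-Reasoning)

open ≡-Reasoning

evenOrOdd : ∀ d → ∃ λ a → d ≡ 2 * a ⊎ d ≡ suc (2 * a)
evenOrOdd zero = 0 , inj₁ refl
evenOrOdd (suc d) with evenOrOdd d
... | a , inj₁ refl = a , inj₂ refl
... | a , inj₂ refl = suc a , inj₁ (sym (*-suc 2 a))

below⇒above : ∀ {m x y} → x + y ≡ 2 * m → x < m → m < y
below⇒above {m} {x} {y} x+y≡2m x<m with m <? y
... | yes m<y = m<y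
... | no m≮y = ⊥-elim (<⇒≢ (+-mono-<-≤ x<m (≮⇒≥ m≮y))
                           (trans x+y≡2m (cong (m +_) (+-identityʳ m))))

above⇒below : ∀ {m x y} → x + y ≡ 2 * m → m < x → y < m
above⇒below {m} {x} {y} x+y≡2m m<x with y <? m
... | yes y<m = y<m
... | no y≮m = ⊥-elim (<⇒≢ (+-mono-<-≤ m<x (≮⇒≥ y≮m))
                           (sym (trans x+y≡2m (cong (m +_) (+-identityʳ m)))))

-- Cancellation step turning the reflection identity of keys into an arc-sum identity.
shift : ∀ {m x y z d} → x + m ≡ y + d → y + z ≡ 2 * m → z + x ≡ m + d
shift {m} {x} {y} {z} {d} x+m≡y+d y+z≡2m = +-cancelʳ-≡ m (z + x) (m + d) (begin
  (z + x) + m  ≡⟨ +-assoc z x m ⟩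
  z + (x + m)  ≡⟨ cong (z +_) x+m≡y+d ⟩
  z + (y + d)  ≡⟨ swap z y d ⟩
  (y + z) + d  ≡⟨ cong (_+ d) y+z≡2m ⟩
  2 * m + d    ≡⟨ regroup m d ⟩
  (m + d) + m  ∎)
  where
  swap : ∀ z y d → z + (y + d) ≡ (y + z) + d
  swap = solve-∀
  regroup : ∀ m d → 2 * m + d ≡ (m + d) + m
  regroup = solve-∀

-- Key m x d : vertex x ∈ [0,2m] carries key d ∈ [0,2m].  The vertices below m get the
-- odd keys in increasing order, the vertices m, …, 2m the even keys in increasing order.
data Key (m : ℕ) : ℕ → ℕ → Set where
  odd  : ∀ a → a < m → Key m a (suc (2 * a))
  even : ∀ a → a ≤ m → Key m (m + a) (2 * a)

Key-bounds : ∀ {m x d} → Key m x d → x ≤ 2 * m × d ≤ 2 * m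
Key-bounds {m} (odd a a<m)  = ≤-trans (<⇒≤ a<m) (m≤m+n m (m + 0)) , *-monoʳ-< 2 a<m
Key-bounds {m} (even a a≤m) = +-monoʳ-≤ m (≤-trans a≤m (m≤m+n m 0)) , *-monoʳ-≤ 2 a≤m

keyOf : ∀ {m x} → x ≤ 2 * m → ∃ (Key m x)
keyOf {m} {x} x≤2m with x <? m
... | yes x<m = suc (2 * x) , odd x x<m
... | no x≮m  = 2 * (x ∸ m) ,
  subst (λ y → Key m y (2 * (x ∸ m))) (m+[n∸m]≡n (≮⇒≥ x≮m)) (even (x ∸ m) x∸m≤m)
  where
  x∸m≤m : x ∸ m ≤ m
  x∸m≤m = subst (x ∸ m ≤_) (+-identityʳ m) (m≤n+o⇒m∸n≤o x m x≤2m)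

vertexOf : ∀ {m d} → d ≤ 2 * m → ∃ λ x → Key m x d
vertexOf {m} {d} d≤2m with evenOrOdd d
... | a , inj₁ refl = m + a , even a (*-cancelˡ-≤ 2 d≤2m)
... | a , inj₂ refl = a , odd a (*-cancelˡ-< 2 a m d≤2m)

Key-functional : ∀ {m x x′ d d′} → Key m x d → Key m x′ d′ → x ≡ x′ → d ≡ d′
Key-functional (odd a _)        (odd _ _)   refl = refl
Key-functional {m} (odd a a<m)  (even b _)  a≡m+b = ⊥-elim (m+n≮m m b (subst (_< m) a≡m+b a<m))
Key-functional {m} (even a _)   (odd b b<m) m+a≡b = ⊥-elim (m+n≮m m a (subst (_< m) (sym m+a≡b) b<m))
Key-functional {m} (even a _)   (even b _)  m+a≡m+b = cong (2 *_) (+-cancelˡ-≡ m a b m+a≡m+b)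

Key-injective : ∀ {m x x′ d d′} → Key m x d → Key m x′ d′ → d ≡ d′ → x ≡ x′
Key-injective (odd a _)      (odd b _)  e = *-cancelˡ-≡ a b 2 (suc-injective e)
Key-injective (odd a _)      (even b _) e = ⊥-elim (even≢odd b a (sym e))
Key-injective (even a _)     (odd b _)  e = ⊥-elim (even≢odd a b e)
Key-injective {m} (even a _) (even b _) e = cong (m +_) (*-cancelˡ-≡ a b 2 e)

Key-reflect : ∀ {m x y d e} → Key m x d → Key m y e → d + e ≡ 2 * m → x + m ≡ y + d
Key-reflect {m} (odd a _) (odd b _) d+e≡2m =
  subst (λ k → a + k ≡ b + suc (2 * a)) half (odd-identity a b)
  where
  double-odd : ∀ a b → 2 * suc (a + b) ≡ suc (2 * a) + suc (2 * b)
  double-odd = solve-∀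
  half : suc (a + b) ≡ m
  half = *-cancelˡ-≡ (suc (a + b)) m 2 (trans (double-odd a b) d+e≡2m)
  odd-identity : ∀ a b → a + suc (a + b) ≡ b + suc (2 * a)
  odd-identity = solve-∀
Key-reflect {m} (odd a _) (even b _) d+e≡2m =
  ⊥-elim (even≢odd m (a + b) (sym (trans (mixed a b) d+e≡2m)))
  where
  mixed : ∀ a b → suc (2 * (a + b)) ≡ suc (2 * a) + 2 * b
  mixed = solve-∀
Key-reflect {m} (even a _) (odd b _) d+e≡2m =
  ⊥-elim (even≢odd m (a + b) (sym (trans (mixed a b) d+e≡2m)))
  where
  mixed : ∀ a b → suc (2 * (a + b)) ≡ 2 * a + suc (2 * b)
  mixed = solve-∀
Key-reflect {m} (even a _) (even b _) d+e≡2m =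
  subst (λ k → (k + a) + k ≡ (k + b) + 2 * a) half (even-identity a b)
  where
  half : a + b ≡ m
  half = *-cancelˡ-≡ (a + b) m 2 (trans (*-distribˡ-+ 2 a b) d+e≡2m)
  even-identity : ∀ a b → ((a + b) + a) + (a + b) ≡ ((a + b) + b) + 2 * a
  even-identity = solve-∀

module Reflection (m : ℕ) where

  opposite-sum : (d : Fin (suc (2 * m))) → toℕ d + toℕ (opposite d) ≡ 2 * m
  opposite-sum d = trans (cong (toℕ d +_) (opposite-prop d)) (m+[n∸m]≡n (s≤s⁻¹ (toℕ<n d)))

  mid : Fin (suc (2 * m))
  mid = fromℕ< (s≤s (m≤m+n m (m + 0)))

  toℕ-mid : toℕ mid ≡ m
  toℕ-mid = toℕ-fromℕ< _

  opposite-mid : opposite mid ≡ mid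
  opposite-mid = toℕ-injective (+-cancelˡ-≡ m _ _ (begin
    m + toℕ (opposite mid)      ≡⟨ cong (_+ toℕ (opposite mid)) (sym toℕ-mid) ⟩
    toℕ mid + toℕ (opposite mid) ≡⟨ opposite-sum mid ⟩
    m + (m + 0)                 ≡⟨ cong (m +_) (trans (+-identityʳ m) (sym toℕ-mid)) ⟩
    m + toℕ mid                 ∎))

  lower : Fin m → Fin (suc (2 * m))
  lower t = inject≤ t (≤-trans (m≤m+n m (m + 0)) (n≤1+n _))

  upper : Fin m → Fin (suc (2 * m))
  upper t = opposite (lower t)

  lower<mid : (t : Fin m) → toℕ (lower t) < m
  lower<mid t = subst (_< m) (sym (toℕ-inject≤ t _)) (toℕ<n t)

  mid<upper : (t : Fin m) → m < toℕ (upper t)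
  mid<upper t = below⇒above (opposite-sum (lower t)) (lower<mid t)

  lower-injective : ∀ {t t′} → lower t ≡ lower t′ → t ≡ t′
  lower-injective = inject≤-injective _ _ _ _

  upper-injective : ∀ {t t′} → upper t ≡ upper t′ → t ≡ t′
  upper-injective {t} {t′} e = lower-injective (begin
    lower t                       ≡⟨ sym (opposite-involutive (lower t)) ⟩
    opposite (upper t)            ≡⟨ cong opposite e ⟩
    opposite (upper t′)           ≡⟨ opposite-involutive (lower t′) ⟩
    lower t′                      ∎)

  lower≢mid : (t : Fin m) → lower t ≢ mid
  lower≢mid t e = <⇒≢ (lower<mid t) (trans (cong toℕ e) toℕ-mid)

  upper≢mid : (t : Fin m) → upper t ≢ mid
  upper≢mid t e = <⇒≢ (mid<upper t) (sym (trans (cong toℕ e) toℕ-mid))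

  lower≢upper : (t t′ : Fin m) → lower t ≢ upper t′
  lower≢upper t t′ e = <⇒≢ (<-trans (lower<mid t) (mid<upper t′)) (cong toℕ e)

  asLower : (d : Fin (suc (2 * m))) (d<m : toℕ d < m) → d ≡ lower (fromℕ< d<m)
  asLower d d<m = toℕ-injective (sym (trans (toℕ-inject≤ _ _) (toℕ-fromℕ< d<m)))

  classify : (d : Fin (suc (2 * m))) → d ≡ mid ⊎ Σ (Fin m) λ t → d ≡ lower t ⊎ d ≡ upper t
  classify d with <-cmp (toℕ d) m
  ... | tri< d<m _ _ = inj₂ (fromℕ< d<m , inj₁ (asLower d d<m))
  ... | tri≈ _ d≡m _ = inj₁ (toℕ-injective (trans d≡m (sym toℕ-mid)))
  ... | tri> _ _ m<d = inj₂ (fromℕ< d̄<m , inj₂ (begin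
        d                              ≡⟨ sym (opposite-involutive d) ⟩
        opposite (opposite d)          ≡⟨ cong opposite (asLower (opposite d) d̄<m) ⟩
        upper (fromℕ< d̄<m)             ∎))
    where
    d̄<m : toℕ (opposite d) < m
    d̄<m = above⇒below (opposite-sum d) m<d

module InvolutionGraph {n : ℕ} (σ : Fin n → Fin n) (σ-involutive : ∀ i → σ (σ i) ≡ i) where

  R : Digraph n
  R i j = does (j ≟ σ i)

  R-arc⇒ : ∀ i j → Arc R i j → j ≡ σ i
  R-arc⇒ i j arc with j ≟ σ i
  ... | yes j≡σi = j≡σi
  R-arc⇒ i j () | no _

  R-arc⇐ : ∀ i j → j ≡ σ i → Arc R i j
  R-arc⇐ i j = dec-true (j ≟ σ i)

  S : Digraph n
  S k i = R i (opposite k)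

  R-rotate : (i j : Fin n) → R i j ≡ rotate S i j
  R-rotate i j = cong (R i) (sym (opposite-involutive j))

  S-arc⇒ : ∀ k i → Arc S k i → k ≡ opposite (σ i)
  S-arc⇒ k i arc = trans (sym (opposite-involutive k)) (cong opposite (R-arc⇒ i (opposite k) arc))

  S-arc⇐ : (i : Fin n) → Arc S (opposite (σ i)) i
  S-arc⇐ i = R-arc⇐ i _ (opposite-involutive (σ i))

  S-oneOut : OneOut S
  S-oneOut k = σ (opposite k) , R-arc⇐ _ (opposite k) (sym (σ-involutive (opposite k))) ,
    λ i arc → trans (sym (σ-involutive i)) (cong σ (sym (R-arc⇒ i (opposite k) arc)))

  S-oneIn : OneIn S
  S-oneIn i = opposite (σ i) , S-arc⇐ i , λ k arc → S-arc⇒ k i arc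

module ConjugatedReflection (m : ℕ) (δ κ : Fin (suc (2 * m)) → Fin (suc (2 * m)))
    (δ∘κ : ∀ x → δ (κ x) ≡ x) (κ∘δ : ∀ d → κ (δ d) ≡ d) where

  open Reflection m

  σ : Fin (suc (2 * m)) → Fin (suc (2 * m))
  σ x = δ (opposite (κ x))

  σ-δ : ∀ d → σ (δ d) ≡ δ (opposite d)
  σ-δ d = cong (δ ∘ opposite) (κ∘δ d)

  σ-involutive : ∀ x → σ (σ x) ≡ x
  σ-involutive x = begin
    σ (δ (opposite (κ x)))        ≡⟨ σ-δ (opposite (κ x)) ⟩
    δ (opposite (opposite (κ x))) ≡⟨ cong δ (opposite-involutive (κ x)) ⟩
    δ (κ x)                       ≡⟨ δ∘κ x ⟩
    x                             ∎

  open InvolutionGraph σ σ-involutive public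

  δ-injective : ∀ {d d′} → δ d ≡ δ d′ → d ≡ d′
  δ-injective {d} {d′} e = trans (sym (κ∘δ d)) (trans (cong κ e) (κ∘δ d′))

  κ-injective : ∀ {x x′} → κ x ≡ κ x′ → x ≡ x′
  κ-injective {x} {x′} e = trans (sym (δ∘κ x)) (trans (cong δ e) (δ∘κ x′))

  R-loopAndDigons : LoopAndDigons m R
  R-loopAndDigons = δ mid , δ ∘ lower , δ ∘ upper ,
    arcs , R-arc⇐ _ _ (sym σ-mid) ,
    (λ t → R-arc⇐ _ _ (sym (σ-lower t)) , R-arc⇐ _ _ (sym (σ-upper t))) ,
    (λ t → (λ e → lower≢upper t t (δ-injective e)) ,
           (λ e → lower≢mid t (δ-injective e)) ,
           (λ e → upper≢mid t (δ-injective e))) ,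
    (λ t t′ t≢t′ → (λ e → t≢t′ (lower-injective (δ-injective e))) ,
                   (λ e → lower≢upper t t′ (δ-injective e)) ,
                   (λ e → lower≢upper t′ t (sym (δ-injective e))) ,
                   (λ e → t≢t′ (upper-injective (δ-injective e)))) ,
    cover
    where
    σ-mid : σ (δ mid) ≡ δ mid
    σ-mid = trans (σ-δ mid) (cong δ opposite-mid)

    σ-lower : ∀ t → σ (δ (lower t)) ≡ δ (upper t)
    σ-lower t = σ-δ (lower t)

    σ-upper : ∀ t → σ (δ (upper t)) ≡ δ (lower t)
    σ-upper t = trans (σ-δ (upper t)) (cong δ (opposite-involutive (lower t)))

    cover : (u : Fin (suc (2 * m))) →
      u ≡ δ mid ⊎ Σ (Fin m) λ t → u ≡ δ (lower t) ⊎ u ≡ δ (upper t)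
    cover u with classify (κ u)
    ... | inj₁ e            = inj₁ (trans (sym (δ∘κ u)) (cong δ e))
    ... | inj₂ (t , inj₁ e) = inj₂ (t , inj₁ (trans (sym (δ∘κ u)) (cong δ e)))
    ... | inj₂ (t , inj₂ e) = inj₂ (t , inj₂ (trans (sym (δ∘κ u)) (cong δ e)))

    arcs : (i j : Fin (suc (2 * m))) → Arc R i j →
      (i ≡ δ mid × j ≡ δ mid) ⊎
      (Σ (Fin m) λ t → (i ≡ δ (lower t) × j ≡ δ (upper t)) ⊎ (i ≡ δ (upper t) × j ≡ δ (lower t)))
    arcs i j arc with cover i
    ... | inj₁ refl            = inj₁ (refl , trans (R-arc⇒ i j arc) σ-mid)
    ... | inj₂ (t , inj₁ refl) = inj₂ (t , inj₁ (refl , trans (R-arc⇒ i j arc) (σ-lower t)))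
    ... | inj₂ (t , inj₂ refl) = inj₂ (t , inj₂ (refl , trans (R-arc⇒ i j arc) (σ-upper t)))

-- δ sends a key d ∈ [0,2m] to the vertex carrying it, κ a vertex to its key.
module KeyPermutation (m : ℕ) where

  open Reflection m using (opposite-sum)

  δ : Fin (suc (2 * m)) → Fin (suc (2 * m))
  δ d = fromℕ< (s≤s (proj₁ (Key-bounds (proj₂ (vertexOf {m} (s≤s⁻¹ (toℕ<n d)))))))

  κ : Fin (suc (2 * m)) → Fin (suc (2 * m))
  κ x = fromℕ< (s≤s (proj₂ (Key-bounds (proj₂ (keyOf {m} (s≤s⁻¹ (toℕ<n x)))))))

  δ-key : ∀ d → Key m (toℕ (δ d)) (toℕ d)
  δ-key d = subst (λ x → Key m x (toℕ d)) (sym (toℕ-fromℕ< _))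
                  (proj₂ (vertexOf {m} (s≤s⁻¹ (toℕ<n d))))

  κ-key : ∀ x → Key m (toℕ x) (toℕ (κ x))
  κ-key x = subst (Key m (toℕ x)) (sym (toℕ-fromℕ< _)) (proj₂ (keyOf {m} (s≤s⁻¹ (toℕ<n x))))

  δ∘κ : ∀ x → δ (κ x) ≡ x
  δ∘κ x = toℕ-injective (Key-injective (δ-key (κ x)) (κ-key x) refl)

  κ∘δ : ∀ d → κ (δ d) ≡ d
  κ∘δ d = toℕ-injective (Key-functional (κ-key (δ d)) (δ-key d) refl)

  δ-reflect : ∀ d → toℕ (δ d) + m ≡ toℕ (δ (opposite d)) + toℕ d
  δ-reflect d = Key-reflect (δ-key d) (δ-key (opposite d)) (opposite-sum d)

module Construction (m : ℕ) where

  open Reflection m using (opposite-sum)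
  open KeyPermutation m
  open ConjugatedReflection m δ κ δ∘κ κ∘δ

  S-arcSum : ∀ k i → Arc S k i → toℕ k + toℕ i ≡ m + toℕ (κ i)
  S-arcSum k i arc = begin
    toℕ k + toℕ i                ≡⟨ cong (λ k → toℕ k + toℕ i) (S-arc⇒ k i arc) ⟩
    toℕ (opposite (σ i)) + toℕ i ≡⟨ shift {m} {toℕ i} {toℕ (σ i)} reflect (opposite-sum (σ i)) ⟩
    m + toℕ (κ i)                ∎
    where
    reflect : toℕ i + m ≡ toℕ (σ i) + toℕ (κ i)
    reflect = subst (λ x → toℕ x + m ≡ toℕ (σ i) + toℕ (κ i)) (δ∘κ i) (δ-reflect (κ i))

  S-labelSum : ∀ k i → Arc S k i → lab k + lab i ≡ suc (suc m) + toℕ (κ i)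
  S-labelSum k i arc = cong suc (trans (+-suc (toℕ k) (toℕ i)) (cong suc (S-arcSum k i arc)))

  -- an arc sum determines its head i (κ is injective), hence also its tail
  S-distinct : DistinctSums S
  S-distinct k i k′ i′ arc arc′ sums≡ = k≡k′ , i≡i′
    where
    i≡i′ : i ≡ i′
    i≡i′ = κ-injective (toℕ-injective (+-cancelˡ-≡ (suc (suc m)) _ _
             (trans (sym (S-labelSum k i arc)) (trans sums≡ (S-labelSum k′ i′ arc′)))))
    k≡k′ : k ≡ k′
    k≡k′ = trans (S-arc⇒ k i arc) (trans (cong (opposite ∘ σ) i≡i′) (sym (S-arc⇒ k′ i′ arc′)))

  S-consecutive : ConsecutiveSums S
  S-consecutive = c , bounds , hit
    where
    c = suc (suc m)
    n = suc (2 * m)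

    bounds : (k i : Fin n) → Arc S k i → c ≤ lab k + lab i × lab k + lab i < c + n
    bounds k i arc = subst (c ≤_) (sym (S-labelSum k i arc)) (m≤m+n c _) ,
                     subst (_< c + n) (sym (S-labelSum k i arc)) (+-monoʳ-< c (toℕ<n (κ i)))

    hit : (t : ℕ) → c ≤ t → t < c + n →
          Σ (Fin n) λ k → Σ (Fin n) λ i → Arc S k i × lab k + lab i ≡ t
    hit t c≤t t<c+n = opposite (σ (δ d)) , δ d , S-arc⇐ (δ d) , (begin
      lab (opposite (σ (δ d))) + lab (δ d) ≡⟨ S-labelSum _ (δ d) (S-arc⇐ (δ d)) ⟩
      c + toℕ (κ (δ d))                    ≡⟨ cong (λ e → c + toℕ e) (κ∘δ d) ⟩
      c + toℕ d                            ≡⟨ cong (c +_) (toℕ-fromℕ< d<n) ⟩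
      c + (t ∸ c)                          ≡⟨ m+[n∸m]≡n c≤t ⟩
      t                                    ∎)
      where
      d<n : t ∸ c < n
      d<n = +-cancelˡ-< c (t ∸ c) n (subst (_< c + n) (sym (m+[n∸m]≡n c≤t)) t<c+n)
      d : Fin n
      d = fromℕ< d<n

  construction : Σ (Digraph (suc (2 * m))) λ R → InRS (suc (2 * m)) R × LoopAndDigons m R
  construction = R , (S , (S-oneOut , S-oneIn , S-distinct , S-consecutive) , R-rotate) ,
                 R-loopAndDigons

odd-form : ∀ n → n % 2 ≡ 1 → ∃ λ m → n ≡ suc (2 * m)
odd-form n n%2≡1 = n / 2 , trans (m≡m%n+[m/n]*n n 2) (cong₂ _+_ n%2≡1 (*-comm (n / 2) 2))

half-double : ∀ m → 2 * m / 2 ≡ m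
half-double m = trans (cong (_/ 2) (*-comm 2 m)) (m*n/n≡m m 2)

lemma4p1 : (n : ℕ) → 1 ≤ n → n % 2 ≡ 1 →
    Σ (Digraph n) λ R → InRS n R × LoopAndDigons ((n ∸ 1) / 2) R
lemma4p1 n _ n%2≡1 with odd-form n n%2≡1
... | m , refl rewrite half-double m = Construction.construction m
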